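{- Let $\mathbf{x}$ be an infinite binary word that avoids $\tfrac73$-powers, i.e. every nonempty finite factor $w$ of $\mathbf{x}$ satisfies $\exp(w)<\tfrac73$. Then $\mathbf{x}$ contains infinitely many (and hence arbitrarily long) complementary factors, i.e. there are infinitely many nonempty words $y$ such that both $y$ and $\overline{y}$ are factors of $\mathbf{x}$.
   Context: For a binary word $y$, $\overline{y}$ is obtained by exchanging $0$ and $1$ in $y$. A finite word $w=w[1..n]$ has period $p\ge 1$ if $w[i]=w[i+p]$ for $1\le i\le n-p$; $\mathrm{per}(w)$ is its smallest period and $\exp(w)=|w|/\mathrm{per}(w)$. A factor of an infinite word $\mathbf{x}$ is a finite word $y$ such that $\mathbf{x}=uy\mathbf{z}$ for some finite word $u$ and infinite word $\mathbf{z}$. -}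

module Defs where

open import Data.Bool using (Bool; not)
open import Data.Nat using (ℕ; zero; suc; _+_; _*_; _<_; _≤_)
open import Data.List using (List; []; _∷_; length; map)
open import Data.Product using (Σ; ∃; _×_)
open import Relation.Binary.PropositionalEquality using (_≡_)
open import Relation.Nullary using (¬_)
open import Data.List.Membership.Propositional using (_∈_)

InfWord : Set
InfWord = ℕ → Bool

slice : InfWord → ℕ → ℕ → List Bool
slice x i zero = []
slice x i (suc n) = x i ∷ slice x (suc i) n

Factor : List Bool → InfWord → Set
Factor y x = ∃ λ i → y ≡ slice x i (length y)

compl : List Bool → List Bool
compl = map not

data At : List Bool → ℕ → Bool → Set where
  here  : ∀ {b w} → At (b ∷ w) zero b
  there : ∀ {a w n b} → At w n b → At (a ∷ w) (suc n) b

HasPeriod : List Bool → ℕ → Set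
HasPeriod w p = (1 ≤ p) × (∀ i a b → At w i a → At w (i + p) b → a ≡ b)

IsPer : List Bool → ℕ → Set
IsPer w p = HasPeriod w p × (∀ q → HasPeriod w q → p ≤ q)

-- exp(w) = |w| / per(w) < 7/3, written as 3|w| < 7 per(w).
ExpLt7/3 : List Bool → Set
ExpLt7/3 w = ∀ p → IsPer w p → 3 * length w < 7 * p

Avoids7/3 : InfWord → Set
Avoids7/3 x = ∀ w → 1 ≤ length w → Factor w x → ExpLt7/3 w

ComplFactor : InfWord → List Bool → Set
ComplFactor x y = (1 ≤ length y) × Factor y x × Factor (compl y) x

InfinitelyMany : (List Bool → Set) → Set
InfinitelyMany P = ∀ (ys : List (List Bool)) → ∃ λ y → P y × ¬ (y ∈ ys)

{-# OPTIONS --safe #-}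
-- A binary word avoiding 7/3-powers has no factor aaa, ababa or abbabba, so two
-- letter squares aa never lie at odd distance and consecutive ones are at most four
-- apart. Beyond the first square, therefore, x is μ(z) for the Thue–Morse morphism
-- μ(a) = a ā. A period p of w gives the period 2p of μ(w), so z again avoids
-- 7/3-powers, and a complementary pair y, ȳ of factors of z yields the pair μ(y),
-- μ(ȳ) of factors of x, which is complementary and twice as long.
module Submission where

open import Defs
open import Data.Bool using (Bool; not) renaming (_≟_ to _≟ᵇ_)
open import Data.Bool.Properties using (¬-not)
open import Data.Empty using (⊥; ⊥-elim)
open import Data.List using (List; []; _∷_; length; map; drop)
open import Data.List.Membership.Propositional using (_∈_)
open import Data.List.Membership.Propositional.Properties using (∈-map⁺)
open import Data.List.Relation.Unary.Any using (here; there)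
open import Data.Nat using (ℕ; zero; suc; _+_; _*_; _<_; _≤_; z≤n; s≤s; _≤?_; _<?_)
open import Data.Nat.ListAction using (sum)
open import Data.Nat.Properties
open import Data.Product using (∃; _×_; _,_; proj₁)
open import Data.Sum using (_⊎_; inj₁; inj₂)
open import Data.Unit using (⊤; tt)
open import Function using (_∘_)
open import Relation.Binary.PropositionalEquality
open import Relation.Nullary using (¬_; Dec; yes; no)
open import Relation.Nullary.Decidable using (_×-dec_; map′; from-no)
open import Relation.Unary using (Decidable)

least : {P : ℕ → Set} → Decidable P → ∀ {n} → P n → ∃ λ m → P m × (∀ k → P k → m ≤ k)
least P? pn with P? 0
... | yes p₀ = 0 , p₀ , λ _ _ → z≤n
least P? {zero}  p₀ | no ¬p₀ = ⊥-elim (¬p₀ p₀)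
least P? {suc n} pn | no ¬p₀ with least (λ k → P? (suc k)) pn
... | m , pm , minimal = suc m , pm , λ
  { zero    p₀ → ⊥-elim (¬p₀ p₀)
  ; (suc k) pk → s≤s (minimal k pk) }

≢-≢⇒≡ : {a b c : Bool} → a ≢ b → b ≢ c → a ≡ c
≢-≢⇒≡ a≢b b≢c = trans (¬-not a≢b) (sym (¬-not (≢-sym b≢c)))

double : ℕ → ℕ
double zero    = zero
double (suc n) = suc (suc (double n))

double≡+ : ∀ n → double n ≡ n + n
double≡+ zero    = refl
double≡+ (suc n) = cong suc (trans (cong suc (double≡+ n)) (sym (+-suc n n)))

*-double : ∀ m n → m * double n ≡ double (m * n)
*-double m n = begin
  m * double n  ≡⟨ cong (m *_) (double≡+ n) ⟩
  m * (n + n)   ≡⟨ *-distribˡ-+ m n n ⟩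
  m * n + m * n ≡⟨ double≡+ (m * n) ⟨
  double (m * n) ∎
  where open ≡-Reasoning

double-cancel-< : ∀ {m n} → double m < double n → m < n
double-cancel-< {zero}  {suc n} _                 = s≤s z≤n
double-cancel-< {suc m} {suc n} (s≤s (s≤s 2m<2n)) = s≤s (double-cancel-< 2m<2n)

<-double : ∀ {n m} → n ≤ m → 1 ≤ m → n < double m
<-double {n} {m} n≤m 1≤m = begin-strict
  n        ≤⟨ n≤m ⟩
  m        <⟨ m<m+n m 1≤m ⟩
  m + m    ≡⟨ double≡+ m ⟨
  double m ∎
  where open ≤-Reasoning

-- HasPeriod w p amounts to 1 ≤ p × Agree w (drop p w): this makes periods decidable,
-- and a period of a concrete word is given as a tuple of letter equalities.
Agree : List Bool → List Bool → Set
Agree []      _       = ⊤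
Agree (_ ∷ _) []      = ⊤
Agree (a ∷ u) (b ∷ v) = a ≡ b × Agree u v

agree? : ∀ u v → Dec (Agree u v)
agree? []      _       = yes tt
agree? (_ ∷ _) []      = yes tt
agree? (a ∷ u) (b ∷ v) = (a ≟ᵇ b) ×-dec agree? u v

Agree⇒At-≡ : ∀ {u v i a b} → Agree u v → At u i a → At v i b → a ≡ b
Agree⇒At-≡ {_ ∷ _} {_ ∷ _} (a≡b , _) here      here      = a≡b
Agree⇒At-≡ {_ ∷ _} {_ ∷ _} (_ , u~v) (there p) (there q) = Agree⇒At-≡ u~v p q

At-≡⇒Agree : ∀ u v → (∀ {i a b} → At u i a → At v i b → a ≡ b) → Agree u v
At-≡⇒Agree []      _       _  = tt
At-≡⇒Agree (_ ∷ _) []      _  = tt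
At-≡⇒Agree (a ∷ u) (b ∷ v) eq = eq here here , At-≡⇒Agree u v (λ p q → eq (there p) (there q))

At-drop⁺ : ∀ p {w i b} → At w (i + p) b → At (drop p w) i b
At-drop⁺ zero    {w} {i} {b} at = subst (λ k → At w k b) (+-identityʳ i) at
At-drop⁺ (suc p) {w} {i} {b} at = shift w (subst (λ k → At w k b) (+-suc i p) at)
  where
  shift : ∀ w → At w (suc (i + p)) b → At (drop (suc p) w) i b
  shift (_ ∷ w) (there at′) = At-drop⁺ p at′

At-drop⁻ : ∀ p {w i b} → At (drop p w) i b → At w (i + p) b
At-drop⁻ zero    {w}     {i} {b} at = subst (λ k → At w k b) (sym (+-identityʳ i)) at
At-drop⁻ (suc p) {a ∷ w} {i} {b} at =
  subst (λ k → At (a ∷ w) k b) (sym (+-suc i p)) (there (At-drop⁻ p at))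

agree⇒hasPeriod : ∀ {w p} → 1 ≤ p → Agree w (drop p w) → HasPeriod w p
agree⇒hasPeriod {p = p} 1≤p w~w′ = 1≤p , λ _ _ _ at at′ → Agree⇒At-≡ w~w′ at (At-drop⁺ p at′)

hasPeriod⇒agree : ∀ {w p} → HasPeriod w p → Agree w (drop p w)
hasPeriod⇒agree {w} {p} (_ , periodic) =
  At-≡⇒Agree w (drop p w) (λ at at′ → periodic _ _ _ at (At-drop⁻ p at′))

hasPeriod? : ∀ w p → Dec (HasPeriod w p)
hasPeriod? w p = map′ (λ (1≤p , w~w′) → agree⇒hasPeriod 1≤p w~w′)
                      (λ hp → proj₁ hp , hasPeriod⇒agree hp)
                      ((1 ≤? p) ×-dec agree? w (drop p w))

μ : List Bool → List Bool
μ []      = []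
μ (a ∷ w) = a ∷ not a ∷ μ w

length-μ : ∀ w → length (μ w) ≡ double (length w)
length-μ []      = refl
length-μ (_ ∷ w) = cong (suc ∘ suc) (length-μ w)

<-length-μ : ∀ {n} w → n ≤ length w → 1 ≤ length w → n < length (μ w)
<-length-μ w n≤w 1≤w = subst (_ <_) (sym (length-μ w)) (<-double n≤w 1≤w)

drop-μ : ∀ p w → drop (double p) (μ w) ≡ μ (drop p w)
drop-μ zero    _       = refl
drop-μ (suc p) []      = refl
drop-μ (suc p) (_ ∷ w) = drop-μ p w

compl-μ : ∀ w → compl (μ w) ≡ μ (compl w)
compl-μ []      = refl
compl-μ (a ∷ w) = cong (λ r → not a ∷ not (not a) ∷ r) (compl-μ w)

agree-μ : ∀ {u v} → Agree u v → Agree (μ u) (μ v)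
agree-μ {[]}             _            = tt
agree-μ {_ ∷ _} {[]}     _            = tt
agree-μ {_ ∷ _} {_ ∷ _} (a≡b , u~v) = a≡b , cong not a≡b , agree-μ u~v

hasPeriod-μ : ∀ {w p} → HasPeriod w p → HasPeriod (μ w) (double p)
hasPeriod-μ {w} {suc p} hp = agree⇒hasPeriod (s≤s z≤n)
  (subst (Agree (μ w)) (sym (drop-μ (suc p) w)) (agree-μ (hasPeriod⇒agree hp)))

length-slice : ∀ x i n → length (slice x i n) ≡ n
length-slice x i zero    = refl
length-slice x i (suc n) = cong suc (length-slice x (suc i) n)

Alternating : InfWord → ℕ → Set
Alternating x s = ∀ k → x (suc (double k + s)) ≡ not (x (double k + s))

decode : InfWord → ℕ → InfWord
decode x s k = x (double k + s)

module _ {x : InfWord} {s : ℕ} (alternating : Alternating x s) where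

  slice-decode : ∀ i n → slice x (double i + s) (double n) ≡ μ (slice (decode x s) i n)
  slice-decode i zero    = refl
  slice-decode i (suc n) =
    cong₂ (λ b r → x (double i + s) ∷ b ∷ r) (alternating i) (slice-decode (suc i) n)

  factor-decode : ∀ {w} → Factor w (decode x s) → Factor (μ w) x
  factor-decode {w} (i , w≡slice) = double i + s , (begin
    μ w                                              ≡⟨ cong μ w≡slice ⟩
    μ (slice (decode x s) i (length w))              ≡⟨ slice-decode i (length w) ⟨
    slice x (double i + s) (double (length w))       ≡⟨ cong (slice x _) (length-μ w) ⟨
    slice x (double i + s) (length (μ w))            ∎)
    where open ≡-Reasoning

module _ {x : InfWord} (avoids : Avoids7/3 x) where

  factor-period-bound : ∀ {w p} → Factor w x → 1 ≤ length w → HasPeriod w p → 3 * length w < 7 * p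
  factor-period-bound {w} w∈x 1≤w hp with least (hasPeriod? w) hp
  ... | q , hq , minimal =
    <-≤-trans (avoids w 1≤w w∈x q (hq , minimal)) (*-monoʳ-≤ 7 (minimal _ hp))

  slice-period-bound : ∀ t n p → 1 ≤ n → 1 ≤ p →
                       Agree (slice x t n) (drop p (slice x t n)) → 3 * n < 7 * p
  slice-period-bound t n p 1≤n 1≤p agree =
    subst (λ m → 3 * m < 7 * p) (length-slice x t n)
      (factor-period-bound (t , cong (slice x t) (sym (length-slice x t n)))
        (subst (1 ≤_) (sym (length-slice x t n)) 1≤n) (agree⇒hasPeriod 1≤p agree))

  avoids-decode : ∀ {s} → Alternating x s → Avoids7/3 (decode x s)
  avoids-decode alternating w 1≤w w∈z p (hp , _) = double-cancel-<
    (subst₂ _<_ (*-double 3 (length w)) (*-double 7 p)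
      (subst (λ m → 3 * m < 7 * double p) (length-μ w)
        (factor-period-bound (factor-decode alternating w∈z) (<-length-μ w z≤n 1≤w) (hasPeriod-μ hp))))

  SquareAt : ℕ → Set
  SquareAt t = x t ≡ x (suc t)

  no-cube : ∀ {t} → SquareAt t → ¬ SquareAt (suc t)
  no-cube {t} sq sq′ = from-no (9 <? 7) (slice-period-bound t 3 1 (s≤s z≤n) (s≤s z≤n) (sq , sq′ , tt))

  no-ababa : ∀ {t} → ¬ SquareAt t → ¬ SquareAt (1 + t) →
             ¬ SquareAt (2 + t) → ¬ SquareAt (3 + t) → ⊥
  no-ababa {t} ¬sq₀ ¬sq₁ ¬sq₂ ¬sq₃ = from-no (15 <? 14)
    (slice-period-bound t 5 2 (s≤s z≤n) (s≤s z≤n)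
      (≢-≢⇒≡ ¬sq₀ ¬sq₁ , ≢-≢⇒≡ ¬sq₁ ¬sq₂ , ≢-≢⇒≡ ¬sq₂ ¬sq₃ , tt))

  no-abbabba : ∀ {u} → SquareAt (1 + u) → ¬ SquareAt (4 + u)
  no-abbabba {u} sq₁ sq₄ = from-no (21 <? 21)
    (slice-period-bound u 7 3 (s≤s z≤n) (s≤s z≤n)
      (≢-≢⇒≡ (λ x₀≡x₂ → no-cube (trans x₀≡x₂ (sym sq₁)) sq₁) ¬sq₂ ,
       trans sq₁ x₂≡x₄ , trans x₂≡x₄ sq₄ ,
       ≢-≢⇒≡ (λ x₃≡x₅ → ¬sq₃ (trans x₃≡x₅ (sym sq₄))) (no-cube sq₄) , tt))
    where
    ¬sq₂ : ¬ SquareAt (2 + u)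
    ¬sq₂ = no-cube sq₁
    ¬sq₃ : ¬ SquareAt (3 + u)
    ¬sq₃ sq₃ = no-cube sq₃ sq₄
    x₂≡x₄ : x (2 + u) ≡ x (4 + u)
    x₂≡x₄ = ≢-≢⇒≡ ¬sq₂ ¬sq₃

  square-gap : ∀ {u} → SquareAt (1 + u) → SquareAt (3 + u) ⊎ SquareAt (5 + u)
  square-gap {u} sq₁ with x (3 + u) ≟ᵇ x (4 + u) | x (5 + u) ≟ᵇ x (6 + u)
  ... | yes sq₃ | _       = inj₁ sq₃
  ... | no _    | yes sq₅ = inj₂ sq₅
  ... | no ¬sq₃ | no ¬sq₅ = ⊥-elim (no-ababa (no-cube sq₁) ¬sq₃ (no-abbabba sq₁) ¬sq₅)

  -- Searched from position 1 on, since no-abbabba needs the letter before the square.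
  some-square : ∃ λ u → SquareAt (suc u)
  some-square with x 1 ≟ᵇ x 2 | x 2 ≟ᵇ x 3 | x 3 ≟ᵇ x 4 | x 4 ≟ᵇ x 5
  ... | yes sq | _      | _      | _      = 0 , sq
  ... | no _   | yes sq | _      | _      = 1 , sq
  ... | no _   | no _   | yes sq | _      = 2 , sq
  ... | no _   | no _   | no _   | yes sq = 3 , sq
  ... | no ¬sq₁ | no ¬sq₂ | no ¬sq₃ | no ¬sq₄ = ⊥-elim (no-ababa ¬sq₁ ¬sq₂ ¬sq₃ ¬sq₄)

  square-at-even-distance : ∀ {u} → SquareAt (1 + u) →
                            ∀ k → SquareAt (1 + (double k + u)) ⊎ SquareAt (3 + (double k + u))
  square-at-even-distance sq zero    = inj₁ sq
  square-at-even-distance sq (suc k) with square-at-even-distance sq k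
  ... | inj₁ sq′ = square-gap sq′
  ... | inj₂ sq′ = inj₁ sq′

  no-square-at-odd-distance : ∀ {u} → SquareAt (1 + u) → ∀ k → ¬ SquareAt (2 + (double k + u))
  no-square-at-odd-distance sq k with square-at-even-distance sq k
  ... | inj₁ sq′ = no-cube sq′
  ... | inj₂ sq′ = λ sq″ → no-cube sq″ sq′

  alternating : ∃ (Alternating x)
  alternating with some-square
  ... | u , sq = 2 + u , λ k → subst (λ m → x (suc m) ≡ not (x m)) (sym (+-suc-suc k u))
                                     (¬-not (≢-sym (no-square-at-odd-distance sq k)))
    where
    +-suc-suc : ∀ k u → double k + suc (suc u) ≡ suc (suc (double k + u))
    +-suc-suc k u = trans (+-suc (double k) (suc u)) (cong suc (+-suc (double k) u))

∈⇒≤sum : ∀ {n ns} → n ∈ ns → n ≤ sum ns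
∈⇒≤sum (here refl)                = m≤m+n _ _
∈⇒≤sum {ns = m ∷ _} (there n∈ns) = ≤-trans (∈⇒≤sum n∈ns) (m≤n+m _ m)

unbounded⇒infinitelyMany : {P : List Bool → Set} →
                           (∀ n → ∃ λ y → n ≤ length y × P y) → InfinitelyMany P
unbounded⇒infinitelyMany long ys with long (suc (sum (map length ys)))
... | y , longer , py = y , py , λ y∈ys → <⇒≱ longer (∈⇒≤sum (∈-map⁺ length y∈ys))

complFactor-≥ : ∀ n x → Avoids7/3 x → ∃ λ y → n ≤ length y × ComplFactor x y
complFactor-≥ n x avoids with alternating avoids
complFactor-≥ zero x avoids | s , alt =
  x s ∷ [] , z≤n , s≤s z≤n , (s , refl) , (suc s , cong (_∷ []) (sym (alt 0)))
complFactor-≥ (suc n) x avoids | s , alt with complFactor-≥ n (decode x s) (avoids-decode avoids alt)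
... | y , n≤y , 1≤y , y∈z , ȳ∈z =
  μ y , <-length-μ y n≤y 1≤y , <-length-μ y z≤n 1≤y , factor-decode alt y∈z ,
  subst (λ w → Factor w x) (sym (compl-μ y)) (factor-decode alt ȳ∈z)

lemma1 : (x : InfWord) → Avoids7/3 x → InfinitelyMany (ComplFactor x)
lemma1 x avoids = unbounded⇒infinitelyMany (λ n → complFactor-≥ n x avoids)
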